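{- Let $p$ be a prime and let $i$ be an integer with $1 \leq i \leq p-2$ that cannot be written as $i \equiv \frac{s}{r-s} \pmod p$ for any relatively prime positive integers $r, s < \sqrt{p}$ with $r \neq s$. Suppose $i \equiv -\frac{s}{r + s} \pmod{p}$ for relatively prime integers $0 < r, s < \sqrt{p}$. Then $x_i + y_i \leq r + s$.
   Context: Let $p$ be a prime. For $1 \leq i \leq p-2$, let $x_i^{\max}, y_i^{\max} \in \{1, \dots, p-1\}$ be the residues with $i\, x_i^{\max} \equiv 1 \pmod p$ and $-(i+1)\, y_i^{\max} \equiv 1 \pmod p$. Define $(x_i, y_i)$ to be the pair of positive integers $(x,y)$ with $x \leq x_i^{\max}$, $y \leq y_i^{\max}$ and $ix + (i+1)y \equiv 0 \pmod p$ for which $x + y$ is minimal (such a pair exists and is unique). Fractions modulo $p$ denote multiplication by modular inverses. -}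

module Defs where

open import Data.Nat as ℕ using (ℕ; _≤_; _<_)
open import Data.Integer as ℤ using (ℤ; +_; _-_; _*_; -_)
open import Data.Integer.Divisibility using (_∣_)
open import Data.Product using (_×_; ∃₂)

infix 4 _≡_[mod_]
_≡_[mod_] : ℤ → ℤ → ℕ → Set
a ≡ b [mod p ] = (+ p) ∣ (a - b)

IsInvResidue : ℕ → ℤ → ℕ → Set
IsInvResidue p a x = (1 ≤ x) × (x < p) × ((a * + x) ≡ + 1 [mod p ])

IsXmax : ℕ → ℕ → ℕ → Set
IsXmax p i x = IsInvResidue p (+ i) x

IsYmax : ℕ → ℕ → ℕ → Set
IsYmax p i y = IsInvResidue p (- (+ (ℕ.suc i))) y

Admissible : ℕ → ℕ → ℕ → ℕ → Set
Admissible p i x y =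
  (1 ≤ x) × (1 ≤ y) ×
  (∃₂ λ xm ym → IsXmax p i xm × IsYmax p i ym × x ≤ xm × y ≤ ym) ×
  ((+ i * + x ℤ.+ + (ℕ.suc i) * + y) ≡ + 0 [mod p ])

-- (x,y) is the admissible pair minimising x + y, i.e. (x_i, y_i)
IsMinPair : ℕ → ℕ → ℕ → ℕ → Set
IsMinPair p i x y =
  Admissible p i x y × (∀ x' y' → Admissible p i x' y' → x ℕ.+ y ≤ x' ℕ.+ y')

-- If r ≤ x_i^max and s ≤ y_i^max, then (r, s) is itself an admissible pair, so the minimal
-- pair is no larger. Otherwise a box side is short: x_i^max < r gives the small representation
-- i ≡ 1 / ((x_i^max + 1) - 1), and y_i^max < s gives i ≡ (y_i^max + 1) / (1 - (y_i^max + 1)),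
-- both excluded by hypothesis.
module Submission where

open import Defs
open import Data.Nat using (ℕ; _≤_; _<_; _+_; _*_)
open import Data.Nat.Primality using (Prime)
open import Data.Nat.Coprimality using (Coprime)
open import Data.Integer as ℤ using (+_; -_)
open import Data.Product using (_×_; ∃₂)
open import Relation.Nullary using (¬_)
open import Relation.Binary.PropositionalEquality using (_≢_)

open import Data.Nat using (suc; s≤s; z≤n)
open import Data.Nat.Properties using (≤-<-trans; *-mono-≤; _≤?_; ≰⇒>; <⇒≢; suc-injective)
import Data.Nat.Coprimality as Coprimality
open import Data.Integer.Divisibility using (_∣_)
open import Data.Integer.Tactic.RingSolver using (solve-∀)
open import Data.Product using (_,_)
open import Relation.Binary.PropositionalEquality using (_≡_; sym; subst)
open import Relation.Nullary using (yes; no; contradiction)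

SmallQuotientPair : ℕ → ℕ → ℕ → ℕ → Set
SmallQuotientPair p i r s =
  Coprime r s × 1 ≤ r × 1 ≤ s × r * r < p × s * s < p × r ≢ s ×
  ((+ i) ℤ.* ((+ r) ℤ.- (+ s)) ≡ + s [mod p ])

square-<-mono : ∀ {a b p} → a ≤ b → b * b < p → a * a < p
square-<-mono a≤b b²<p = ≤-<-trans (*-mono-≤ a≤b a≤b) b²<p

admissible-of-≤max : ∀ {p i xm ym r s} → IsXmax p i xm → IsYmax p i ym →
  1 ≤ r → 1 ≤ s → r ≤ xm → s ≤ ym →
  (+ i) ℤ.* (+ (r + s)) ≡ - (+ s) [mod p ] → Admissible p i r s
admissible-of-≤max {p} {i} {r = r} {s = s} xmax ymax 1≤r 1≤s r≤xm s≤ym i[r+s]≡-s =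
  1≤r , 1≤s , (_ , _ , xmax , ymax , r≤xm , s≤ym) ,
  subst ((+ p) ∣_) (sym (identity (+ i) (+ r) (+ s))) i[r+s]≡-s
  where
  identity : ∀ i r s → (i ℤ.* r ℤ.+ (ℤ.1ℤ ℤ.+ i) ℤ.* s) ℤ.- ℤ.0ℤ ≡ i ℤ.* (r ℤ.+ s) ℤ.- (ℤ.- s)
  identity = solve-∀

xmax-smallQuotientPair : ∀ {p i xm} → IsXmax p i xm →
  suc xm * suc xm < p → SmallQuotientPair p i (suc xm) 1
xmax-smallQuotientPair {p} {i} {xm} (1≤xm , _ , i·xm≡1) xm+1²<p =
  Coprimality.sym (Coprimality.1-coprimeTo (suc xm)) , s≤s z≤n , s≤s z≤n , xm+1²<p ,
  square-<-mono {b = suc xm} (s≤s z≤n) xm+1²<p , (λ eq → <⇒≢ 1≤xm (sym (suc-injective eq))) ,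
  subst ((+ p) ∣_) (identity (+ i) (+ xm)) i·xm≡1
  where
  identity : ∀ i t → i ℤ.* t ℤ.- ℤ.1ℤ ≡ i ℤ.* ((ℤ.1ℤ ℤ.+ t) ℤ.- ℤ.1ℤ) ℤ.- ℤ.1ℤ
  identity = solve-∀

ymax-smallQuotientPair : ∀ {p i ym} → IsYmax p i ym →
  suc ym * suc ym < p → SmallQuotientPair p i 1 (suc ym)
ymax-smallQuotientPair {p} {i} {ym} (1≤ym , _ , -[i+1]·ym≡1) ym+1²<p =
  Coprimality.1-coprimeTo (suc ym) , s≤s z≤n , s≤s z≤n ,
  square-<-mono {b = suc ym} (s≤s z≤n) ym+1²<p , ym+1²<p , (λ eq → <⇒≢ 1≤ym (suc-injective eq)) ,
  subst ((+ p) ∣_) (identity (+ i) (+ ym)) -[i+1]·ym≡1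
  where
  identity : ∀ i t → (ℤ.- (ℤ.1ℤ ℤ.+ i)) ℤ.* t ℤ.- ℤ.1ℤ ≡ i ℤ.* (ℤ.1ℤ ℤ.- (ℤ.1ℤ ℤ.+ t)) ℤ.- (ℤ.1ℤ ℤ.+ t)
  identity = solve-∀

lemma2p8 : (p i : ℕ) → Prime p → 1 ≤ i → i + 2 ≤ p →
    ¬ (∃₂ λ (r s : ℕ) → Coprime r s × 1 ≤ r × 1 ≤ s × r * r < p × s * s < p × r ≢ s ×
         ((+ i) ℤ.* ((+ r) ℤ.- (+ s)) ≡ + s [mod p ])) →
    (r s : ℕ) → Coprime r s → 1 ≤ r → 1 ≤ s → r * r < p → s * s < p →
    ((+ i) ℤ.* (+ (r + s)) ≡ - (+ s) [mod p ]) →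
    (x y : ℕ) → IsMinPair p i x y → x + y ≤ r + s
lemma2p8 p i _ _ _ noSmallQuotient r s _ 1≤r 1≤s r²<p s²<p i[r+s]≡-s x y
  ((_ , _ , (xm , ym , xmax , ymax , _) , _) , minimal)
  with r ≤? xm | s ≤? ym
... | yes r≤xm | yes s≤ym =
  minimal r s (admissible-of-≤max {p} {i} xmax ymax 1≤r 1≤s r≤xm s≤ym i[r+s]≡-s)
... | no r≰xm | _ =
  contradiction (_ , _ , xmax-smallQuotientPair {p} {i} xmax (square-<-mono (≰⇒> r≰xm) r²<p))
    noSmallQuotient
... | _ | no s≰ym =
  contradiction (_ , _ , ymax-smallQuotientPair {p} {i} ymax (square-<-mono (≰⇒> s≰ym) s²<p))
    noSmallQuotient
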